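{- Let $k\ge2$. For every $M\in\{1,2,\dots\}\cup\{\infty\}$ and every $N\in\{1,2,\dots\}$, the oriented graph $\vec{SW}_{k,N,M}$ weakly covers $\vec{SW}_{k,N-1,M}$. For every $i\in\{1,2,\dots\}$, $M\in\{1,2,\dots\}\cup\{\infty\}$ and $N\in\{0,1,2,\dots\}$, the oriented graph $\vec{SW}_{k,N,iM}$ weakly covers $\vec{SW}_{k,N,M}$ (with $i\cdot\infty=\infty$).
   Context: Loops and multiple edges allowed. A morphism $\phi$ of oriented graphs maps vertices to vertices and edges to edges compatibly with initial and terminal vertices; it is a covering if for every vertex $v$ it maps the set of edges with initial vertex $v$ bijectively onto the set of edges with initial vertex $\phi(v)$; "weakly" means labels are ignored. The oriented spider-web graph $\vec{SW}_{k,N,M}$ has vertex set $\{0,\dots,k-1\}^N\times\mathbb Z/M\mathbb Z$ (with $\mathbb Z/\infty\mathbb Z:=\mathbb Z$) and, for each vertex $(x_1\dots x_N,i)$ and each $y\in\{0,\dots,k-1\}$, one edge from $(x_1\dots x_N,i)$ to $(x_2\dots x_Ny,i+1)$. -}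

module Defs where

open import Data.Nat using (ℕ; zero; suc; _*_; _%_; NonZero)
open import Data.Nat.Properties using (m*n≢0)
open import Data.Nat.DivMod using (m%n<n)
open import Data.Integer as ℤ using (ℤ)
open import Data.Fin using (Fin; toℕ; fromℕ<)
open import Data.Vec using (Vec; []; _∷_; _∷ʳ_)
open import Data.Product using (Σ; ∃; _×_; _,_; proj₁)
open import Relation.Binary.PropositionalEquality using (_≡_)

record Graph : Set₁ where
  field
    V    : Set
    E    : Set
    init : E → V
    term : E → V
open Graph

record Morphism (G H : Graph) : Set where
  field
    φV : V G → V H
    φE : E G → E H
    init-comm : ∀ e → init H (φE e) ≡ φV (init G e)
    term-comm : ∀ e → term H (φE e) ≡ φV (term G e)
open Morphism

IsCovering : {G H : Graph} → Morphism G H → Set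
IsCovering {G} {H} φ =
  ∀ (v : V G) →
    (∀ (e₁ e₂ : E G) → init G e₁ ≡ v → init G e₂ ≡ v → φE φ e₁ ≡ φE φ e₂ → e₁ ≡ e₂)
    × (∀ (e' : E H) → init H e' ≡ φV φ v → ∃ λ (e : E G) → init G e ≡ v × φE φ e ≡ e')

-- G weakly covers H: there is a covering morphism G → H (labels ignored).
WeaklyCovers : Graph → Graph → Set
WeaklyCovers G H = Σ (Morphism G H) IsCovering

data Modulus : Set where
  fin : (m : ℕ) → .{{NonZero m}} → Modulus
  ∞   : Modulus

ZMod : Modulus → Set
ZMod (fin m) = Fin m
ZMod ∞       = ℤ

succMod : (M : Modulus) → ZMod M → ZMod M
succMod (fin m) j = fromℕ< (m%n<n (suc (toℕ j)) m)
succMod ∞       j = ℤ.suc j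

_·ᴹ_ : (i : ℕ) → .{{NonZero i}} → Modulus → Modulus
(i ·ᴹ fin m) = fin (i * m) {{m*n≢0 i m}}
(i ·ᴹ ∞)     = ∞

shift : {A : Set} {n : ℕ} → Vec A n → A → Vec A n
shift []       y = []
shift (x ∷ xs) y = xs ∷ʳ y

SW : (k N : ℕ) → Modulus → Graph
SW k N M = record
  { V    = Vec (Fin k) N × ZMod M
  ; E    = (Vec (Fin k) N × ZMod M) × Fin k
  ; init = proj₁
  ; term = λ { ((x , i) , y) → (shift x y , succMod M i) }
  }

-- Both coverings are of the form (x , j) ↦ (f x , g j) on vertices and keep the
-- edge label y.  Since the edges leaving a vertex v are exactly the pairs (v , y),
-- such a map is a covering as soon as it is a graph morphism, i.e. as soon as f
-- commutes with appending a letter and g with i ↦ i + 1.  Forgetting the first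
-- letter and reducing ℤ/iMℤ → ℤ/Mℤ do so.
module Submission where

open import Defs
open import Data.Nat using (ℕ; suc; _≤_; NonZero; _%_; _*_; _+_)
open import Data.Nat.DivMod using (m%n<n; m%n%n≡m%n; %-distribˡ-+; m∣n⇒o%n%m≡o%m)
open import Data.Nat.Divisibility using (divides)
open import Data.Nat.Properties using (m*n≢0)
open import Data.Product using (∃; _×_; _,_; proj₂)
open import Data.Fin using (Fin; toℕ; fromℕ<)
open import Data.Fin.Properties using (toℕ-injective; toℕ-fromℕ<)
open import Data.Vec using (Vec; []; _∷_; tail)
open import Relation.Binary.PropositionalEquality

module _ {k N N′ : ℕ} {M M′ : Modulus}
         (f : Vec (Fin k) N → Vec (Fin k) N′) (g : ZMod M → ZMod M′)
         (f-shift : ∀ x y → f (shift x y) ≡ shift (f x) y)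
         (g-succMod : ∀ j → g (succMod M j) ≡ succMod M′ (g j)) where

  SW-morphism : Morphism (SW k N M) (SW k N′ M′)
  SW-morphism = record
    { φV        = λ { (x , j) → (f x , g j) }
    ; φE        = λ { ((x , j) , y) → ((f x , g j) , y) }
    ; init-comm = λ _ → refl
    ; term-comm = λ { ((x , j) , y) → cong₂ _,_ (sym (f-shift x y)) (sym (g-succMod j)) }
    }

  SW-morphism-isCovering : IsCovering SW-morphism
  SW-morphism-isCovering v = injective , surjective
    where
    injective : ∀ e₁ e₂ → Graph.init (SW k N M) e₁ ≡ v → Graph.init (SW k N M) e₂ ≡ v →
                Morphism.φE SW-morphism e₁ ≡ Morphism.φE SW-morphism e₂ → e₁ ≡ e₂
    injective (_ , y₁) (_ , y₂) refl refl φe₁≡φe₂ = cong (v ,_) (cong proj₂ φe₁≡φe₂)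

    surjective : ∀ e′ → Graph.init (SW k N′ M′) e′ ≡ Morphism.φV SW-morphism v →
                 ∃ λ e → Graph.init (SW k N M) e ≡ v × Morphism.φE SW-morphism e ≡ e′
    surjective (_ , y) refl = (v , y) , refl , refl

  SW-weaklyCovers : WeaklyCovers (SW k N M) (SW k N′ M′)
  SW-weaklyCovers = SW-morphism , SW-morphism-isCovering

tail-shift : ∀ {A : Set} {n} (x : Vec A (suc n)) y → tail (shift x y) ≡ shift (tail x) y
tail-shift (_ ∷ [])    _ = refl
tail-shift (_ ∷ _ ∷ _) _ = refl

[1+m%n]%n≡[1+m]%n : ∀ m n .{{_ : NonZero n}} → suc (m % n) % n ≡ suc m % n
[1+m%n]%n≡[1+m]%n m n = begin
  (1 + m % n) % n           ≡⟨ %-distribˡ-+ 1 (m % n) n ⟩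
  (1 % n + m % n % n) % n   ≡⟨ cong (λ r → (1 % n + r) % n) (m%n%n≡m%n m n) ⟩
  (1 % n + m % n) % n       ≡⟨ %-distribˡ-+ 1 m n ⟨
  (1 + m) % n               ∎
  where open ≡-Reasoning

reduce : (i : ℕ) .{{_ : NonZero i}} (M : Modulus) → ZMod (i ·ᴹ M) → ZMod M
reduce i (fin m) j = fromℕ< (m%n<n (toℕ j) m)
reduce i ∞       j = j

reduce-succMod : (i : ℕ) .{{_ : NonZero i}} (M : Modulus) (j : ZMod (i ·ᴹ M)) →
                 reduce i M (succMod (i ·ᴹ M) j) ≡ succMod M (reduce i M j)
reduce-succMod i ∞       j = refl
reduce-succMod i (fin m) j = toℕ-injective (begin
  toℕ (fromℕ< (m%n<n (toℕ (fromℕ< (m%n<n (suc (toℕ j)) (i * m)))) m))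
    ≡⟨ toℕ-fromℕ< _ ⟩
  toℕ (fromℕ< (m%n<n (suc (toℕ j)) (i * m))) % m
    ≡⟨ cong (_% m) (toℕ-fromℕ< _) ⟩
  suc (toℕ j) % (i * m) % m
    ≡⟨ m∣n⇒o%n%m≡o%m m (i * m) (suc (toℕ j)) (divides i refl) ⟩
  suc (toℕ j) % m
    ≡⟨ [1+m%n]%n≡[1+m]%n (toℕ j) m ⟨
  suc (toℕ j % m) % m
    ≡⟨ cong (λ r → suc r % m) (toℕ-fromℕ< _) ⟨
  suc (toℕ (fromℕ< (m%n<n (toℕ j) m))) % m
    ≡⟨ toℕ-fromℕ< _ ⟨
  toℕ (succMod (fin m) (fromℕ< (m%n<n (toℕ j) m)))
    ∎)
  where
  open ≡-Reasoning
  instance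
    im≢0 : NonZero (i * m)
    im≢0 = m*n≢0 i m

proposition6p15 : (k : ℕ) → 2 ≤ k →
    ((M : Modulus) (N : ℕ) → WeaklyCovers (SW k (suc N) M) (SW k N M))
    × ((i : ℕ) → .{{_ : NonZero i}} → (M : Modulus) (N : ℕ) →
        WeaklyCovers (SW k N (i ·ᴹ M)) (SW k N M))
proposition6p15 k _ = forgetFirstLetter , reduceModulus
  where
  forgetFirstLetter : (M : Modulus) (N : ℕ) → WeaklyCovers (SW k (suc N) M) (SW k N M)
  forgetFirstLetter M N = SW-weaklyCovers tail (λ j → j) tail-shift (λ _ → refl)

  reduceModulus : (i : ℕ) → .{{_ : NonZero i}} → (M : Modulus) (N : ℕ) →
                  WeaklyCovers (SW k N (i ·ᴹ M)) (SW k N M)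
  reduceModulus i M N = SW-weaklyCovers (λ x → x) (reduce i M) (λ _ _ → refl) (reduce-succMod i M)
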